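{- For all integers $n\ge 2$, \[ S_{\mathrm{SCF}}(n)\le 6\,\frac{\log n}{\log 2}. \]
   Context: The second canonical form of a positive integer $n$ is the formula in $1$, $+$, $\times$, $\wedge$ defined recursively: $1$ is encoded as $1$; if $n=p_1^{\alpha_1}\cdots p_r^{\alpha_r}$ is the prime factorization, $n$ is encoded as the product (with $r-1$ multiplications) of the encodings of the factors $p_i^{\alpha_i}$, where $p_i^{\alpha_i}$ is encoded as $\mathrm{enc}(p_i)$ if $\alpha_i=1$ and as $\mathrm{enc}(p_i)^{\mathrm{enc}(\alpha_i)}$ if $\alpha_i\ge2$, and each prime $p$ is encoded as $1+\mathrm{enc}(p-1)$. Its length $S_{\mathrm{SCF}}(n)$ is the number of symbols $1,+,\times,\wedge$ (parentheses not counted); explicitly $S_{\mathrm{SCF}}(1)=1$, $S_{\mathrm{SCF}}(p)=2+S_{\mathrm{SCF}}(p-1)$ for $p$ prime, and for $n=p_1^{\alpha_1}\cdots p_r^{\alpha_r}$ not prime, $S_{\mathrm{SCF}}(n)=(r-1)+\sum_{i:\alpha_i=1}S_{\mathrm{SCF}}(p_i)+\sum_{i:\alpha_i\ge2}\big(1+S_{\mathrm{SCF}}(p_i)+S_{\mathrm{SCF}}(\alpha_i)\big)$. For example $2430=((1+1)\times(1+(1+1))^{(1+(1+1)^{(1+1)})})\times(1+(1+1)^{(1+1)})$. -}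

module Defs where

open import Data.Nat using (ℕ; zero; suc; _+_; _*_; _∸_; _^_; _≤_; _≤?_; NonZero)
open import Data.Nat.DivMod using (_/_)
open import Data.Nat.Divisibility using (_∣?_)
open import Data.Nat.Primality using (Prime; prime?)
open import Data.Product using (_×_; _,_)
open import Data.List using (List; []; _∷_; length; map)
open import Data.Nat.ListAction using (sum)
open import Relation.Nullary using (yes; no)
open import Relation.Nullary.Decidable using (_×-dec_)

-- p-adic stripping with fuel:  strip f p n = (α , n / p^α) with α the
-- multiplicity of p in n (fuel f ≥ n suffices for n ≥ 1, p ≥ 2).
strip : ℕ → (p : ℕ) → .{{NonZero p}} → ℕ → ℕ × ℕ
strip zero    p n = 0 , n
strip (suc f) p n with p ∣? n
... | no  _ = 0 , n
... | yes _ with strip f p (n / p)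
...   | a , r = suc a , r

-- Prime factorisation by trial division with fuel.
-- factors f k n lists the pairs (p , α) with p prime, p ≥ 2 + k, p^α ∥ n,
-- in increasing order of p.
factors : ℕ → ℕ → ℕ → List (ℕ × ℕ)
factors zero    k n = []
factors (suc f) k n with n ≤? 1
... | yes _ = []
... | no  _ with prime? (2 + k) ×-dec ((2 + k) ∣? n)
...   | no  _ = factors f (suc k) n
...   | yes _ with strip n (2 + k) n
...     | a , r = (2 + k , a) ∷ factors f (suc k) r

factorization : ℕ → List (ℕ × ℕ)
factorization n = factors n 0 n

-- Length of the second canonical form, with fuel (fuel ≥ n suffices).
S-fuel : ℕ → ℕ → ℕ
S-fuel zero    n = 0
S-fuel (suc f) zero = 0            -- n = 0 is not a positive integer; junk value
S-fuel (suc f) (suc zero) = 1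
S-fuel (suc f) n@(suc (suc _)) with prime? n
... | yes _ = 2 + S-fuel f (n ∸ 1)
... | no  _ = (length fs ∸ 1) + sum (map cost fs)
  where
  fs : List (ℕ × ℕ)
  fs = factorization n
  cost : ℕ × ℕ → ℕ
  cost (p , suc zero) = S-fuel f p
  cost (p , α)        = 1 + S-fuel f p + S-fuel f α

S-SCF : ℕ → ℕ
S-SCF n = S-fuel n n

open import Relation.Binary.PropositionalEquality using (_≡_; refl)
private
  t1 : S-SCF 2430 ≡ 29
  t1 = refl
  t2 : map S-SCF (1 ∷ 2 ∷ 3 ∷ 4 ∷ 5 ∷ 6 ∷ 8 ∷ 12 ∷ []) ≡ (1 ∷ 3 ∷ 5 ∷ 7 ∷ 9 ∷ 9 ∷ 9 ∷ 13 ∷ [])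
  t2 = refl

module Submission where

-- Say that m fits s if 2^(s+1) ≤ m^6, and moreover 2^(s+3) ≤ m^6 when m
-- is even.  We show that every m ≥ 2 fits S_SCF(m); dropping the factor 2
-- gives the theorem, since 2^S ≤ n^6 is S ≤ 6 log n / log 2.
--   * Product rule: if x fits s and y fits t then x·y fits 1 + s + t (the 1
--     pays for the multiplication sign), so a product of r prime powers
--     fits (r - 1) + the sum of their costs -- the composite case.
--   * A prime power p^α, α ≥ 2, costs 1 + S(p) + S(α), which is exactly the
--     product-rule charge for p·α, and p·α ≤ p^α.
--   * An odd prime p costs 2 + S(p-1) with p-1 even; the two spare factors
--     of 2 of the even case pay for the extra "1 +".
-- S-SCF is computed with fuel, so the induction runs on the fuel f with the
-- invariant "every 2 ≤ m ≤ f fits S-fuel f m".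

open import Defs
open import Data.Nat
open import Data.Nat.Properties
open import Data.Nat.DivMod using (_/_; m/n<m; m≥n⇒m/n>0; m*[n/m]≡n)
open import Data.Nat.Divisibility
open import Data.Nat.Primality
open import Data.Nat.ListAction using (sum; product)
open import Data.Nat.Tactic.RingSolver using (solve-∀)
open import Data.Product using (_×_; _,_; proj₁; proj₂)
open import Data.Sum using (inj₂; [_,_]′)
open import Data.List using (List; []; _∷_; length; map)
open import Data.List.Relation.Unary.All using (All; []; _∷_)
open import Function using (_∘_; id)
open import Relation.Nullary using (¬_; yes; no; contradiction)
open import Relation.Nullary.Decidable using (_×-dec_)
open import Relation.Binary.PropositionalEquality
import Algebra.Properties.CommutativeSemiring.Exp +-*-commutativeSemiring as Exp

strip-split : ∀ f p .{{_ : NonZero p}} n →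
              n ≡ p ^ proj₁ (strip f p n) * proj₂ (strip f p n)
strip-split zero    p n = sym (+-identityʳ n)
strip-split (suc f) p n with p ∣? n
... | no  _   = sym (+-identityʳ n)
... | yes p∣n with strip f p (n / p) | strip-split f p (n / p)
...   | α , r | n/p≡ = begin
  n               ≡⟨ m*[n/m]≡n p∣n ⟨
  p * (n / p)     ≡⟨ cong (p *_) n/p≡ ⟩
  p * (p ^ α * r) ≡⟨ *-assoc p (p ^ α) r ⟨
  p ^ suc α * r   ∎
  where open ≡-Reasoning

strip-positive : ∀ f p .{{_ : NonZero p}} n → 1 ≤ f → p ∣ n → 1 ≤ proj₁ (strip f p n)
strip-positive (suc f) p n _ p∣n with p ∣? n
... | no  p∤n = contradiction p∣n p∤n
... | yes _ with strip f p (n / p)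
...   | _ , _ = s≤s z≤n

strip-exhaustive : ∀ f p .{{_ : NonZero p}} n .{{_ : NonZero n}} →
                   1 < p → n ≤ f → p ∤ proj₂ (strip f p n)
strip-exhaustive zero    p (suc n) _ ()
strip-exhaustive (suc f) p n 1<p n≤1+f with p ∣? n
... | no  p∤n = p∤n
... | yes p∣n with strip f p (n / p) | strip-exhaustive f p (n / p) {{n/p≢0}} 1<p n/p≤f
  where
  n/p≢0 : NonZero (n / p)
  n/p≢0 = >-nonZero (m≥n⇒m/n>0 (∣⇒≤ p∣n))
  n/p≤f : n / p ≤ f
  n/p≤f = s≤s⁻¹ (≤-trans (m/n<m n p 1<p) n≤1+f)
...   | _ , _ | p∤r = p∤r

PrimePower : ℕ × ℕ → Set
PrimePower (p , α) = Prime p × 1 ≤ α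

power : ℕ × ℕ → ℕ
power (p , α) = p ^ α

IsFactorisation : ℕ → List (ℕ × ℕ) → Set
IsFactorisation n fs = All PrimePower fs × product (map power fs) ≡ n

-- Handing one unit of fuel over to the trial divisor keeps the total budget.
fuel-shift : ∀ f k → suc f + suc k ≡ f + suc (suc k)
fuel-shift f k = sym (+-suc f (suc k))

-- Trial division from 2 + k is correct as long as n has no nontrivial
-- divisor below 2 + k (so 2 + k, if it divides n, is prime) and the fuel
-- suffices to reach n.
factors-spec : ∀ f k n .{{_ : NonZero n}} → (2 + k) Rough n → n ≤ f + suc k →
               IsFactorisation n (factors f k n)
factors-spec zero k (suc zero) _ _ = [] , refl
factors-spec zero k n@(suc (suc _)) rough n≤1+k =
  contradiction (≤-trans (rough⇒≤ rough) n≤1+k) 1+n≰n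
factors-spec (suc f) k n {{n≢0}} rough n≤fuel with n ≤? 1
... | yes n≤1 = [] , ≤-antisym (>-nonZero⁻¹ n) n≤1
... | no  _ with prime? (2 + k) ×-dec ((2 + k) ∣? n)
...   | no ¬p∣n =
  factors-spec f (suc k) n (∤⇒rough-suc k∤n rough) (≤-trans n≤fuel (≤-reflexive (fuel-shift f k)))
  where
  k∤n : (2 + k) ∤ n
  k∤n d = ¬p∣n (rough∧∣⇒prime rough d , d)
...   | yes (prime-p , p∣n)
        with strip n (2 + k) n | strip-split n (2 + k) n
           | strip-exhaustive n (2 + k) n (s≤s (s≤s z≤n)) ≤-refl
           | strip-positive n (2 + k) n (>-nonZero⁻¹ n) p∣n
...     | α , r | n≡ | p∤r | 1≤α =
  (prime-p , 1≤α) ∷ proj₁ rest , trans (cong ((2 + k) ^ α *_) (proj₂ rest)) (sym n≡)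
  where
  r∣n : r ∣ n
  r∣n = divides ((2 + k) ^ α) n≡
  instance
    r≢0 : NonZero r
    r≢0 = m*n≢0⇒n≢0 ((2 + k) ^ α) {{subst NonZero n≡ n≢0}}
  rest : IsFactorisation r (factors f (suc k) r)
  rest = factors-spec f (suc k) r
           (∤⇒rough-suc p∤r (rough∧∣⇒rough rough r∣n))
           (≤-trans (∣⇒≤ r∣n) (≤-trans n≤fuel (≤-reflexive (fuel-shift f k))))

factorisation-spec : ∀ n .{{_ : NonZero n}} → IsFactorisation n (factorization n)
factorisation-spec n = factors-spec n 0 n 2-rough (m≤m+n n 1)

prime⇒2≤ : ∀ {p} → Prime p → 2 ≤ p
prime⇒2≤ {p} pp = nonTrivial⇒n>1 p {{prime⇒nonTrivial pp}}

prime∣^⇒∣ : ∀ {q} p α → Prime q → q ∣ p ^ α → q ∣ p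
prime∣^⇒∣ p zero    pq q∣1 = contradiction (∣1⇒≡1 q∣1) (nonTrivial⇒≢1 {{prime⇒nonTrivial pq}})
prime∣^⇒∣ p (suc α) pq q∣p^α+1 =
  [ id , prime∣^⇒∣ p α pq ]′ (euclidsLemma p (p ^ α) pq q∣p^α+1)

odd-suc⇒even : ∀ m → 2 ∤ suc m → 2 ∣ m
odd-suc⇒even zero          _   = 2 ∣0
odd-suc⇒even (suc zero)    odd = contradiction ∣-refl odd
odd-suc⇒even (suc (suc m)) odd =
  ∣m∣n⇒∣m+n ∣-refl (odd-suc⇒even m (odd ∘ ∣m∣n⇒∣m+n ∣-refl))

odd-prime : ∀ {p} → Prime p → 3 ≤ p → 2 ∤ p
odd-prime pp 3≤p 2∣p with prime⇒irreducible pp 2∣p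
... | inj₂ refl = 1+n≰n 3≤p

suc≤^ : ∀ {p} → 2 ≤ p → ∀ b → suc b ≤ p ^ b
suc≤^ {p} 2≤p zero    = ≤-refl
suc≤^ {p} 2≤p (suc b) = begin
  2 + b           ≤⟨ s≤s (m≤n+m (suc b) b) ⟩
  suc b + suc b   ≡⟨ cong (suc b +_) (+-identityʳ (suc b)) ⟨
  2 * suc b       ≤⟨ *-mono-≤ 2≤p (suc≤^ 2≤p b) ⟩
  p * p ^ b       ∎
  where open ≤-Reasoning

*≤^ : ∀ {p} → 2 ≤ p → ∀ b → p * suc b ≤ p ^ suc b
*≤^ {p} 2≤p b = *-monoʳ-≤ p (suc≤^ 2≤p b)

record Fits (s m : ℕ) : Set where
  constructor fits
  field
    bound      : 2 ^ (1 + s) ≤ m ^ 6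
    even-bound : 2 ∣ m → 2 ^ (3 + s) ≤ m ^ 6

^6-bound-* : ∀ a b x y → 2 ^ a ≤ x ^ 6 → 2 ^ b ≤ y ^ 6 → 2 ^ (a + b) ≤ (x * y) ^ 6
^6-bound-* a b x y 2^a≤ 2^b≤ = begin
  2 ^ (a + b)     ≡⟨ ^-distribˡ-+-* 2 a b ⟩
  2 ^ a * 2 ^ b   ≤⟨ *-mono-≤ 2^a≤ 2^b≤ ⟩
  x ^ 6 * y ^ 6   ≡⟨ Exp.^-distrib-* x y 6 ⟨
  (x * y) ^ 6     ∎
  where open ≤-Reasoning

-- Product rule: the extra 1 pays for the multiplication sign.  If x·y is
-- even, the spare factors of 2 come from the even factor.
fits-* : ∀ {s t x y} → Fits s x → Fits t y → Fits (suc (s + t)) (x * y)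
fits-* {s} {t} {x} {y} (fits x-fits x-even) (fits y-fits y-even) =
  fits (combine (1 + s) (1 + t) odd-exp x-fits y-fits) λ 2∣xy →
    [ (λ 2∣x → combine (3 + s) (1 + t) even-exp₁ (x-even 2∣x) y-fits)
    , (λ 2∣y → combine (1 + s) (3 + t) even-exp₂ x-fits (y-even 2∣y))
    ]′ (euclidsLemma x y prime[2] 2∣xy)
  where
  combine : ∀ a b {e} → a + b ≡ e → 2 ^ a ≤ x ^ 6 → 2 ^ b ≤ y ^ 6 → 2 ^ e ≤ (x * y) ^ 6
  combine a b refl = ^6-bound-* a b x y
  odd-exp : (1 + s) + (1 + t) ≡ 1 + suc (s + t)
  odd-exp = cong suc (+-suc s t)
  even-exp₁ : (3 + s) + (1 + t) ≡ 3 + suc (s + t)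
  even-exp₁ = cong (3 +_) (+-suc s t)
  even-exp₂ : (1 + s) + (3 + t) ≡ 3 + suc (s + t)
  even-exp₂ = rearrange s t
    where
    rearrange : ∀ s t → (1 + s) + (3 + t) ≡ 3 + suc (s + t)
    rearrange = solve-∀

fits-mono : ∀ {s x y} → Fits s x → x ≤ y → (2 ∣ y → 2 ∣ x) → Fits s y
fits-mono (fits x-fits x-even) x≤y parity =
  fits (≤-trans x-fits (^-monoˡ-≤ 6 x≤y)) λ 2∣y → ≤-trans (x-even (parity 2∣y)) (^-monoˡ-≤ 6 x≤y)

fits-product : ∀ {A : Set} (c w : A → ℕ) x xs → All (λ y → Fits (c y) (w y)) (x ∷ xs) →
               Fits (length xs + sum (map c (x ∷ xs))) (product (map w (x ∷ xs)))
fits-product c w x []       (x-fits ∷ []) =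
  subst₂ Fits (sym (+-identityʳ (c x))) (sym (*-identityʳ (w x))) x-fits
fits-product c w x (y ∷ ys) (x-fits ∷ rest) =
  subst (λ s → Fits s (product (map w (x ∷ y ∷ ys))))
        (cong suc (x+[l+r]≡l+[x+r] (c x) (length ys) (sum (map c (y ∷ ys)))))
        (fits-* x-fits (fits-product c w y ys rest))
  where
  x+[l+r]≡l+[x+r] : ∀ a l r → a + (l + r) ≡ l + (a + r)
  x+[l+r]≡l+[x+r] = solve-∀

-- An odd number following an even one: the cost 2 + s of "1 + (·)" is
-- paid for by the spare factors of 2 of the even predecessor.
fits-suc : ∀ {s m} → Fits s m → 2 ∣ m → 2 ∤ suc m → Fits (2 + s) (suc m)
fits-suc {m = m} (fits _ m-even) 2∣m odd =
  fits (≤-trans (m-even 2∣m) (^-monoˡ-≤ 6 (n≤1+n m))) λ 2∣m+1 → contradiction 2∣m+1 odd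

-- c is the cost of a factor p^α in the second canonical form, with the
-- lengths of p and α computed with fuel f (the local cost of S-fuel).
record IsFactorCost (f : ℕ) (c : ℕ × ℕ → ℕ) : Set where
  field
    cost-prime : ∀ p → c (p , 1) ≡ S-fuel f p
    cost-power : ∀ p b → c (p , 2 + b) ≡ 1 + S-fuel f p + S-fuel f (2 + b)

Bound : ℕ → Set
Bound f = ∀ m → 2 ≤ m → m ≤ f → Fits (S-fuel f m) m

-- A prime power fits its cost: for α = 1 this is the invariant at p, for
-- α ≥ 2 the cost 1 + S(p) + S(α) is the product-rule cost of p·α ≤ p^α.
prime-power-fits : ∀ {f c} → Bound f → IsFactorCost f c → ∀ {p} α →
                   Prime p → 1 ≤ α → p ≤ f → α ≤ f → Fits (c (p , α)) (p ^ α)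
prime-power-fits bnd cost {p} (suc zero) pp _ p≤f _ =
  subst₂ Fits (sym (cost-prime p)) (sym (*-identityʳ p)) (bnd p (prime⇒2≤ pp) p≤f)
  where open IsFactorCost cost
prime-power-fits bnd cost {p} α@(suc (suc b)) pp _ p≤f α≤f =
  subst (λ s → Fits s (p ^ α)) (sym (cost-power p b))
    (fits-mono (fits-* (bnd p (prime⇒2≤ pp) p≤f) (bnd α (s≤s (s≤s z≤n)) α≤f))
               (*≤^ (prime⇒2≤ pp) (suc b))
               (λ 2∣p^α → ∣m⇒∣m*n α (prime∣^⇒∣ p α prime[2] 2∣p^α)))
  where open IsFactorCost cost

factor-bounds : ∀ {f n p} α .{{_ : NonZero n}} → ¬ Prime n → n ≤ suc f →
                Prime p → 1 ≤ α → p ^ α ∣ n → p ≤ f × α ≤ f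
factor-bounds {f} {n} {p} (suc b) np n≤1+f pp _ p^α∣n =
  s≤s⁻¹ (≤-trans p<n n≤1+f) , s≤s⁻¹ (≤-trans α<n n≤1+f)
  where
  p^α≤n : p ^ suc b ≤ n
  p^α≤n = ∣⇒≤ p^α∣n
  p<n : p < n
  p<n = ≤∧≢⇒< (≤-trans (m≤m*n p (suc b)) (≤-trans (*≤^ (prime⇒2≤ pp) b) p^α≤n))
              (λ { refl → np pp })
  α<n : suc b < n
  α<n = ≤-trans (suc≤^ (prime⇒2≤ pp) (suc b)) p^α≤n

factors-fit : ∀ {f c n} .{{_ : NonZero n}} → Bound f → IsFactorCost f c →
              ¬ Prime n → n ≤ suc f → ∀ fs → All PrimePower fs →
              product (map power fs) ∣ n → All (λ y → Fits (c y) (power y)) fs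
factors-fit bnd cost np n≤1+f []             []                 _      = []
factors-fit {f} bnd cost np n≤1+f ((p , α) ∷ fs) ((pp , 1≤α) ∷ pps) prod∣n =
  prime-power-fits bnd cost α pp 1≤α (proj₁ bounds) (proj₂ bounds)
  ∷ factors-fit bnd cost np n≤1+f fs pps (m*n∣⇒n∣ (p ^ α) _ prod∣n)
  where
  bounds : p ≤ f × α ≤ f
  bounds = factor-bounds α np n≤1+f pp 1≤α (m*n∣⇒m∣ (p ^ α) _ prod∣n)

composite-fits : ∀ {f c} n .{{_ : NonTrivial n}} → Bound f → IsFactorCost f c →
                 n ≤ suc f → ¬ Prime n →
                 Fits ((length (factorization n) ∸ 1) + sum (map c (factorization n))) n
composite-fits {c = c} n {{n>1}} bnd cost n≤1+f np
  with factorization n | factorisation-spec n {{nonTrivial⇒nonZero n}}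
... | []     | _ , 1≡n       = contradiction (sym 1≡n) (nonTrivial⇒≢1 {{n>1}})
... | x ∷ xs | pps , prod≡n =
  subst (Fits _) prod≡n
    (fits-product c power x xs
       (factors-fit {{nonTrivial⇒nonZero n}} bnd cost np n≤1+f (x ∷ xs) pps (∣-reflexive prod≡n)))

-- A prime p = 1 + m ≤ 1 + f fits its length 2 + S(m): for p = 2 directly,
-- for odd p because m is even.
prime-fits : ∀ {f} m → Bound f → Prime (suc m) → suc m ≤ suc f → Fits (2 + S-fuel f m) (suc m)
prime-fits zero _ prime-1 _ = contradiction prime-1 ¬prime[1]
prime-fits {zero}  (suc zero) _ _ (s≤s ())
prime-fits {suc f} (suc zero) _ _ _ = fits (^-monoʳ-≤ 2 (m≤m+n 4 2)) (λ _ → ≤-refl)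
prime-fits m@(suc (suc _)) bnd pp p≤1+f =
  fits-suc (bnd m (s≤s (s≤s z≤n)) (s≤s⁻¹ p≤1+f)) (odd-suc⇒even m p-odd) p-odd
  where
  p-odd : 2 ∤ suc m
  p-odd = odd-prime pp (s≤s (s≤s (s≤s z≤n)))

-- One more unit of fuel: S-fuel (1 + f) m unfolds into lengths with fuel f;
-- in the composite case its local cost function is a factor cost by definition.
bound-step : ∀ {f} → Bound f → Bound (suc f)
bound-step _ (suc zero) (s≤s ()) _
bound-step bnd m@(suc (suc k)) _ m≤1+f with prime? m
... | yes pm = prime-fits (suc k) bnd pm m≤1+f
... | no  np = composite-fits m bnd
                 (record { cost-prime = λ _ → refl ; cost-power = λ _ _ → refl }) m≤1+f np

bound : ∀ f → Bound f
bound zero    m 2≤m m≤0 = contradiction (≤-trans 2≤m m≤0) λ ()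
bound (suc f) = bound-step (bound f)

theorem1p6 : (n : ℕ) → 2 ≤ n → 2 ^ S-SCF n ≤ n ^ 6
theorem1p6 n 2≤n = ≤-trans (^-monoʳ-≤ 2 (n≤1+n (S-SCF n))) (Fits.bound (bound n n 2≤n ≤-refl))
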